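{- Let $\lambda$ be a strict partition, $k\ge1$, and let $R$ be a $k$-ribbon occurring in a standard shifted $k$-ribbon tableau of shape $\lambda$. Then $R$ contains a cell of the main diagonal of $\lambda$ if and only if $\mathrm{diag}(R)\le k$.
   Context: Conventions. Diagrams are drawn in French convention, with rows numbered from the bottom. A strict partition $\lambda=(\lambda_1>\cdots>\lambda_\ell>0)$ is identified with its shifted diagram $\{(c,r):1\le r\le\ell,\ r\le c\le r+\lambda_r-1\}$. The diagonal value of a cell is $\mathrm{diag}(c,r)=c-r+1$, and the main diagonal consists of the cells of value $1$. A subset $R\subseteq\lambda$ is removable if $\lambda\setminus R$ is a shifted diagram. Ribbons. A single ribbon is a nonempty edge-connected skew-shifted diagram whose cells have pairwise distinct diagonal values. Its head $H(R)$ and tail $T(R)$ are its cells of largest and smallest diagonal value. A double ribbon in $\lambda$ is a union $R\cup S$ of two disjoint single ribbons with $|R|\ge|S|$ such that $T(R)$ lies on the main diagonal of $\lambda$, $T(S)$ lies on the main diagonal of $\lambda\setminus R$, and $R\cup S$ is skew-shifted. Its head is $H(R)$. A $k$-ribbon is a single or double ribbon with $k$ cells. For any ribbon, $\mathrm{diag}(R):=\mathrm{diag}(H(R))$. A $k$-core is a shifted diagram with no removable $k$-ribbon. A standard shifted $k$-ribbon tableau of shape $\lambda$ is a chain $\lambda^{(0)}\subset\cdots\subset\lambda^{(n)}=\lambda$ such that $\lambda^{(0)}$ is a $k$-core and each $\lambda^{(i)}\setminus\lambda^{(i-1)}$ is a removable $k$-ribbon of $\lambda^{(i)}$. Its ribbons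 are these differences. -}

module Defs where

open import Data.Nat using (ℕ; zero; suc; _+_; _∸_; _≤_; _<_; _>_; _⊔_)
open import Data.Product using (Σ; ∃; _×_; _,_)
open import Data.Sum using (_⊎_)
open import Data.List using (List; []; _∷_; _++_; length; foldr)
open import Data.List.Membership.Propositional using (_∈_; _∉_)
open import Data.List.Relation.Unary.All using (All)
open import Data.List.Relation.Unary.Linked using (Linked)
open import Data.List.Relation.Unary.Unique.Propositional using (Unique)
open import Relation.Binary.PropositionalEquality using (_≡_)
open import Relation.Nullary using (¬_)
open import Function.Bundles using (_⇔_)

-- Cells and shifted diagrams (French convention, rows from the bottom)

-- A cell (c , r): column c, row r (both 1-based).
Cell : Set
Cell = ℕ × ℕ

-- diag(c , r) = c - r + 1  (for cells with r ≤ c, which is all cells of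
-- shifted diagrams)
diagC : Cell → ℕ
diagC (c , r) = suc c ∸ r

StrictPartition : List ℕ → Set
StrictPartition λ′ = All (λ n → 0 < n) λ′ × Linked _>_ λ′

-- rowLen λ r = λ_r (1-indexed; 0 outside 1..ℓ)
rowLen : List ℕ → ℕ → ℕ
rowLen [] r = 0
rowLen (x ∷ xs) zero = 0
rowLen (x ∷ xs) (suc zero) = x
rowLen (x ∷ xs) (suc (suc r)) = rowLen xs (suc r)

InD : List ℕ → Cell → Set
InD λ′ (c , r) = 1 ≤ r × r ≤ c × c < r + rowLen λ′ r

-- Finite sets of cells are represented by lists (duplicate-free where
-- cardinality matters).

_⊆D_ : List Cell → List ℕ → Set
X ⊆D μ = ∀ {x} → x ∈ X → InD μ x

SkewShifted : List Cell → Set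
SkewShifted X = Σ (List ℕ) λ μ → Σ (List ℕ) λ ν →
  StrictPartition μ × StrictPartition ν ×
  (∀ x → InD ν x → InD μ x) ×
  (∀ x → (x ∈ X) ⇔ (InD μ x × ¬ InD ν x))

Step : Cell → Cell → Set
Step (c , r) (c′ , r′) = (c′ ≡ suc c × r′ ≡ r) ⊎ (c′ ≡ c × r′ ≡ suc r)

Adj : Cell → Cell → Set
Adj x y = Step x y ⊎ Step y x

data Path (X : List Cell) : Cell → Cell → Set where
  stop : ∀ {x} → Path X x x
  go   : ∀ {x y z} → Adj x y → y ∈ X → Path X y z → Path X x z

EdgeConnected : List Cell → Set
EdgeConnected X = ∀ {x y} → x ∈ X → y ∈ X → Path X x y

DistinctDiag : List Cell → Set
DistinctDiag X = ∀ {x y} → x ∈ X → y ∈ X → diagC x ≡ diagC y → x ≡ y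

SingleRibbon : List Cell → Set
SingleRibbon X = Unique X × (∃ λ x → x ∈ X) × SkewShifted X ×
                 EdgeConnected X × DistinctDiag X

IsHead : List Cell → Cell → Set
IsHead X h = h ∈ X × (∀ {y} → y ∈ X → diagC y ≤ diagC h)

IsTail : List Cell → Cell → Set
IsTail X t = t ∈ X × (∀ {y} → y ∈ X → diagC t ≤ diagC y)

maxDiag : List Cell → ℕ
maxDiag = foldr (λ x m → diagC x ⊔ m) 0

DoubleRibbon : List ℕ → List Cell → List Cell → Set
DoubleRibbon λ′ R S =
  SingleRibbon R × SingleRibbon S ×
  (∀ {x} → x ∈ R → x ∉ S) ×
  length S ≤ length R ×
  R ⊆D λ′ × S ⊆D λ′ ×
  (∃ λ t → IsTail R t × InD λ′ t × diagC t ≡ 1) ×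
  (∃ λ t → IsTail S t × InD λ′ t × t ∉ R × diagC t ≡ 1) ×
  SkewShifted (R ++ S)

data KRibbon (k : ℕ) (λ′ : List ℕ) : List Cell → Set where
  single : ∀ {X} → SingleRibbon X → X ⊆D λ′ → length X ≡ k → KRibbon k λ′ X
  double : ∀ {R S} → DoubleRibbon λ′ R S → length R + length S ≡ k →
           KRibbon k λ′ (R ++ S)

-- diag(R) := diag(H(R)); for a double ribbon R ∪ S the head is H(R)
ribbonDiag : ∀ {k λ′ X} → KRibbon k λ′ X → ℕ
ribbonDiag (single {X} _ _ _) = maxDiag X
ribbonDiag (double {R} _ _) = maxDiag R

Removable : List ℕ → List Cell → Set
Removable λ′ X = X ⊆D λ′ × Σ (List ℕ) λ ν → StrictPartition ν ×
  (∀ x → InD ν x ⇔ (InD λ′ x × x ∉ X))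

KCore : ℕ → List ℕ → Set
KCore k λ′ = ¬ (Σ (List Cell) λ X → KRibbon k λ′ X × Removable λ′ X)

-- Standard shifted k-ribbon tableaux of shape λ, as chains
-- λ⁽⁰⁾ ⊂ ... ⊂ λ⁽ⁿ⁾ = λ

data SRT (k : ℕ) : List ℕ → Set where
  start : ∀ μ → StrictPartition μ → KCore k μ → SRT k μ
  step  : ∀ {ν} μ → StrictPartition μ → SRT k ν →
          (∀ x → InD ν x → InD μ x) →
          (X : List Cell) → KRibbon k μ X → Removable μ X →
          (∀ x → (x ∈ X) ⇔ (InD μ x × ¬ InD ν x)) →
          SRT k μ

data RibbonOf {k : ℕ} : ∀ {λ′} → SRT k λ′ →
       (μ : List ℕ) (X : List Cell) → KRibbon k μ X → Set where
  here  : ∀ {ν μ sμ} {T : SRT k ν} {inc X ρ rem eq} →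
          RibbonOf (step μ sμ T inc X ρ rem eq) μ X ρ
  there : ∀ {ν μ sμ} {T : SRT k ν} {inc X ρ rem eq μ′ X′ ρ′} →
          RibbonOf T μ′ X′ ρ′ →
          RibbonOf (step μ sμ T inc X ρ rem eq) μ′ X′ ρ′

module Submission where

open import Defs
open import Data.Nat using (ℕ; _≤_)
open import Data.Product using (Σ; _×_)
open import Data.List using (List)
open import Data.List.Membership.Propositional using (_∈_)
open import Relation.Binary.PropositionalEquality using (_≡_)
open import Function.Bundles using (_⇔_)

open import Data.Nat using (suc; _+_; _∸_; _<_; _≟_; _≤?_; z≤n; s≤s)
open import Data.Nat.Properties
open import Data.Product using (_,_; proj₁; ∃)
open import Data.Sum using (inj₁; inj₂)
open import Data.List using ([]; _∷_; _++_; length; map; applyUpTo)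
open import Data.List.Properties using (length-map; length-applyUpTo)
open import Data.List.Relation.Unary.Any using (here; there)
open import Data.List.Relation.Unary.All as All using ()
open import Data.List.Relation.Unary.All.Properties using (map⁺)
open import Data.List.Relation.Unary.AllPairs using ([]; _∷_)
open import Data.List.Relation.Unary.Unique.Propositional using (Unique)
open import Data.List.Relation.Unary.Unique.Propositional.Properties using (applyUpTo⁺₁)
open import Data.List.Relation.Binary.Subset.Propositional using (_⊆_)
open import Data.List.Membership.Propositional.Properties
  using (∈-map⁺; ∈-map⁻; ∈-++⁺ˡ; ∈-applyUpTo⁺; ∈-applyUpTo⁻)
open import Relation.Binary.Definitions using (DecidableEquality)
open import Relation.Binary.PropositionalEquality using (_≢_; refl; sym; trans; cong; subst)
open import Relation.Nullary using (yes; no)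
open import Data.Empty using (⊥-elim)
open import Function.Bundles using (mk⇔)

-- Every cell (c , r) of a shifted diagram has r ≤ c, so its
-- diagonal value is at least 1, and edge-adjacent cells have diagonal
-- values differing by at most one.  Two counting facts about a set X of
-- such cells follow:
--   * (cover)  if X is edge-connected and meets the main diagonal, a path
--     from a diagonal cell to the head passes through every diagonal value
--     in [1, diag(X)], so diag(X) ≤ |X|;
--   * (spread) if the cells of X have pairwise distinct diagonal values,
--     all lying in [diag(T), diag(X)], then |X| + diag(T) ≤ diag(X) + 1.
-- For a single ribbon, cover gives "meets diagonal ⇒ diag ≤ |X|", and
-- spread gives the converse (the tail is then forced onto diagonal 1).
-- A double ribbon R ∪ S always meets the diagonal (at the tail of R), and
-- cover applied to R gives diag(R) ≤ |R| ≤ k.  Finally, every ribbon of a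
-- tableau lives in a subdiagram of λ, which transports diagonal cells.

module _ {a} {A : Set a} (_≟ᴬ_ : DecidableEquality A) where

  delete : A → List A → List A
  delete x [] = []
  delete x (y ∷ ys) with x ≟ᴬ y
  ... | yes _ = ys
  ... | no  _ = y ∷ delete x ys

  length-delete : ∀ {x ys} → x ∈ ys → suc (length (delete x ys)) ≡ length ys
  length-delete {x} {y ∷ ys} x∈ with x ≟ᴬ y | x∈
  ... | yes _   | _         = refl
  ... | no  x≢y | here x≡y  = ⊥-elim (x≢y x≡y)
  ... | no  _   | there x∈′ = cong suc (length-delete x∈′)

  ∈-delete : ∀ {x v ys} → v ∈ ys → v ≢ x → v ∈ delete x ys
  ∈-delete {x} {v} {y ∷ ys} v∈ v≢x with x ≟ᴬ y | v∈
  ... | yes x≡y | here v≡y  = ⊥-elim (v≢x (trans v≡y (sym x≡y)))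
  ... | yes _   | there v∈′ = v∈′
  ... | no  _   | here v≡y  = here v≡y
  ... | no  _   | there v∈′ = there (∈-delete v∈′ v≢x)

  unique-⊆⇒length-≤ : ∀ {xs ys} → Unique xs → xs ⊆ ys → length xs ≤ length ys
  unique-⊆⇒length-≤ {[]} _ _ = z≤n
  unique-⊆⇒length-≤ {x ∷ xs} {ys} (x∉xs ∷ uniq) xs⊆ys =
    subst (suc (length xs) ≤_) (length-delete (xs⊆ys (here refl)))
      (s≤s (unique-⊆⇒length-≤ uniq rest⊆))
    where
    rest⊆ : xs ⊆ delete x ys
    rest⊆ v∈ = ∈-delete (xs⊆ys (there v∈)) (λ v≡x → All.lookup x∉xs v∈ (sym v≡x))

map-unique : ∀ {a b} {A : Set a} {B : Set b} (f : A → B) {xs : List A} →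
  Unique xs → (∀ {x y} → x ∈ xs → y ∈ xs → f x ≡ f y → x ≡ y) →
  Unique (map f xs)
map-unique f [] _ = []
map-unique f (x∉xs ∷ uniq) inj =
  map⁺ (All.tabulate (λ y∈ fx≡fy → All.lookup x∉xs y∈ (inj (here refl) (there y∈) fx≡fy)))
  ∷ map-unique f uniq (λ x∈ y∈ → inj (there x∈) (there y∈))

interval : ℕ → ℕ → List ℕ
interval a n = applyUpTo (a +_) n

∈-interval⁺ : ∀ {a n v} → a ≤ v → v < a + n → v ∈ interval a n
∈-interval⁺ {a} {n} {v} a≤v v<a+n =
  subst (_∈ interval a n) (m+[n∸m]≡n a≤v)
    (∈-applyUpTo⁺ (a +_) (+-cancelˡ-< a (v ∸ a) n
      (subst (_< a + n) (sym (m+[n∸m]≡n a≤v)) v<a+n)))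

∈-interval⁻ : ∀ {a n v} → v ∈ interval a n → a ≤ v × v < a + n
∈-interval⁻ {a} v∈ with ∈-applyUpTo⁻ (a +_) v∈
... | i , i<n , refl = m≤m+n a i , +-monoʳ-< a i<n

interval-unique : ∀ a n → Unique (interval a n)
interval-unique a n = applyUpTo⁺₁ (a +_) n (λ i<j _ → <⇒≢ (+-monoʳ-< a i<j))

length-≤-interval : ∀ {a n xs} → Unique xs → xs ⊆ interval a n → length xs ≤ n
length-≤-interval {a} {n} uniq xs⊆ =
  subst (_ ≤_) (length-applyUpTo (a +_) n) (unique-⊆⇒length-≤ _≟_ uniq xs⊆)

interval-≤-length : ∀ {a n xs} → interval a n ⊆ xs → n ≤ length xs
interval-≤-length {a} {n} ⊆xs =
  subst (_≤ _) (length-applyUpTo (a +_) n)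
    (unique-⊆⇒length-≤ _≟_ (interval-unique a n) ⊆xs)

Shifted : Cell → Set
Shifted (c , r) = r ≤ c

AllShifted : List Cell → Set
AllShifted X = ∀ {x} → x ∈ X → Shifted x

InD⇒Shifted : ∀ {μ x} → InD μ x → Shifted x
InD⇒Shifted (_ , r≤c , _) = r≤c

⊆D⇒AllShifted : ∀ {X μ} → X ⊆D μ → AllShifted X
⊆D⇒AllShifted {μ = μ} X⊆μ x∈ = InD⇒Shifted {μ} (X⊆μ x∈)

diagC-positive : ∀ {x} → Shifted x → 1 ≤ diagC x
diagC-positive {c , r} r≤c = subst (1 ≤_) (sym (+-∸-assoc 1 r≤c)) (s≤s z≤n)

diagC-adjacent : ∀ {x y} → Shifted x → Shifted y → Adj x y → diagC y ≤ suc (diagC x)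
diagC-adjacent {c , r} r≤c _ (inj₁ (inj₁ (refl , refl))) = ≤-reflexive (+-∸-assoc 1 (m≤n⇒m≤1+n r≤c))
diagC-adjacent {c , r} _ _ (inj₁ (inj₂ (refl , refl))) = ≤-trans (∸-monoˡ-≤ r (n≤1+n c)) (n≤1+n _)
diagC-adjacent {_} {c , r} _ _ (inj₂ (inj₁ (refl , refl))) = ≤-trans (∸-monoˡ-≤ r (n≤1+n (suc c))) (n≤1+n _)
diagC-adjacent {_} {c , r} _ r≤c (inj₂ (inj₂ (refl , refl))) = ≤-reflexive (+-∸-assoc 1 r≤c)

path-meets-diagonals : ∀ {X x z} → AllShifted X → x ∈ X → Path X x z →
  ∀ v → diagC x ≤ v → v ≤ diagC z → ∃ λ w → w ∈ X × diagC w ≡ v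
path-meets-diagonals _ x∈ stop v lo hi = _ , x∈ , ≤-antisym lo hi
path-meets-diagonals {x = x} shifted x∈ (go adj y∈ path) v lo hi with diagC x ≟ v
... | yes x≡v = x , x∈ , x≡v
... | no  x≢v = path-meets-diagonals shifted y∈ path v
                  (≤-trans (diagC-adjacent (shifted x∈) (shifted y∈) adj) (≤∧≢⇒< lo x≢v)) hi

maxDiag-upper : ∀ {X y} → y ∈ X → diagC y ≤ maxDiag X
maxDiag-upper {_ ∷ _} (here refl) = m≤m⊔n _ _
maxDiag-upper {_ ∷ _} (there y∈)  = ≤-trans (maxDiag-upper y∈) (m≤n⊔m _ _)

head-exists : ∀ a xs → ∃ λ h → h ∈ a ∷ xs × diagC h ≡ maxDiag (a ∷ xs)
head-exists a [] = a , here refl , sym (⊔-identityʳ _)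
head-exists a (b ∷ ys) with head-exists b ys | ⊔-sel (diagC a) (maxDiag (b ∷ ys))
... | _ , _  , _   | inj₁ a-wins = a , here refl , sym a-wins
... | h , h∈ , h≡m | inj₂ h-wins = h , there h∈ , trans h≡m (sym h-wins)

tail-exists : ∀ a xs → ∃ (IsTail (a ∷ xs))
tail-exists a [] = a , here refl , λ { (here refl) → ≤-refl }
tail-exists a (b ∷ ys) with tail-exists b ys
... | t , t∈ , t-min with diagC a ≤? diagC t
...   | yes a≤t = a , here refl , λ { (here refl) → ≤-refl ; (there y∈) → ≤-trans a≤t (t-min y∈) }
...   | no  a≰t = t , there t∈ , λ { (here refl) → <⇒≤ (≰⇒> a≰t) ; (there y∈) → t-min y∈ }

-- Cover: an edge-connected set of shifted cells meeting the main diagonal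
-- realises every diagonal value in [1, maxDiag X], hence maxDiag X ≤ |X|.
diagonal-cover : ∀ {X t} → AllShifted X → EdgeConnected X →
  t ∈ X → diagC t ≡ 1 → maxDiag X ≤ length X
diagonal-cover {a ∷ xs} {t} shifted connected t∈ t-diag with head-exists a xs
... | h , h∈ , h-max = begin
  maxDiag (a ∷ xs)            ≡⟨ sym h-max ⟩
  diagC h                     ≤⟨ interval-≤-length values-realised ⟩
  length (map diagC (a ∷ xs)) ≡⟨ length-map diagC (a ∷ xs) ⟩
  length (a ∷ xs)             ∎
  where
  open ≤-Reasoning
  values-realised : interval 1 (diagC h) ⊆ map diagC (a ∷ xs)
  values-realised {v} v∈ with ∈-interval⁻ v∈
  ... | 1≤v , v<1+h with path-meets-diagonals shifted t∈ (connected t∈ h∈) v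
                           (subst (_≤ v) (sym t-diag) 1≤v) (≤-pred v<1+h)
  ...   | w , w∈ , refl = ∈-map⁺ diagC w∈

diagonal-spread : ∀ {X t} → Unique X → DistinctDiag X → IsTail X t →
  length X + diagC t ≤ suc (maxDiag X)
diagonal-spread {X} {t} uniq distinct (t∈ , t-min) =
  m≤o∸n⇒m+n≤o (length X) t≤1+max
    (subst (_≤ suc (maxDiag X) ∸ diagC t) (length-map diagC X)
      (length-≤-interval (map-unique diagC uniq distinct) values-in-range))
  where
  t≤1+max : diagC t ≤ suc (maxDiag X)
  t≤1+max = m≤n⇒m≤1+n (maxDiag-upper t∈)
  values-in-range : map diagC X ⊆ interval (diagC t) (suc (maxDiag X) ∸ diagC t)
  values-in-range v∈ with ∈-map⁻ diagC v∈
  ... | y , y∈ , refl = ∈-interval⁺ (t-min y∈)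
        (subst (diagC y <_) (sym (m+[n∸m]≡n t≤1+max)) (s≤s (maxDiag-upper y∈)))

tail-on-diagonal : ∀ {X t} → AllShifted X → Unique X → DistinctDiag X →
  IsTail X t → maxDiag X ≤ length X → diagC t ≡ 1
tail-on-diagonal {X} {t} shifted uniq distinct tail max≤len =
  ≤-antisym (+-cancelˡ-≤ (length X) (diagC t) 1 len+t≤len+1)
            (diagC-positive (shifted (proj₁ tail)))
  where
  len+t≤len+1 : length X + diagC t ≤ length X + 1
  len+t≤len+1 = begin
    length X + diagC t ≤⟨ diagonal-spread uniq distinct tail ⟩
    suc (maxDiag X)    ≤⟨ s≤s max≤len ⟩
    suc (length X)     ≡⟨ +-comm 1 (length X) ⟩
    length X + 1       ∎
    where open ≤-Reasoning

SubDiagram : List ℕ → List ℕ → Set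
SubDiagram μ λ′ = ∀ x → InD μ x → InD λ′ x

MeetsDiagonal : List ℕ → List Cell → Set
MeetsDiagonal λ′ X = Σ Cell (λ x → x ∈ X × InD λ′ x × diagC x ≡ 1)

ribbon-shape-inside : ∀ {k λ′ μ X ρ} {T : SRT k λ′} → RibbonOf T μ X ρ → SubDiagram μ λ′
ribbon-shape-inside here = λ _ x∈μ → x∈μ
ribbon-shape-inside (there {inc = ν⊆μ} ribbon) = λ x x∈ → ν⊆μ x (ribbon-shape-inside ribbon x x∈)

single-ribbon-diagonal : ∀ {X μ λ′} → SingleRibbon X → X ⊆D μ → SubDiagram μ λ′ →
  MeetsDiagonal λ′ X ⇔ (maxDiag X ≤ length X)
single-ribbon-diagonal {a ∷ xs} {μ} {λ′} (uniq , _ , _ , connected , distinct) X⊆μ μ⊆λ =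
  mk⇔ (λ (_ , x∈ , _ , x-diag) → diagonal-cover shifted connected x∈ x-diag) meets
  where
  shifted : AllShifted (a ∷ xs)
  shifted = ⊆D⇒AllShifted {μ = μ} X⊆μ
  meets : maxDiag (a ∷ xs) ≤ length (a ∷ xs) → MeetsDiagonal λ′ (a ∷ xs)
  meets max≤len with tail-exists a xs
  ... | t , tail = t , proj₁ tail , μ⊆λ t (X⊆μ (proj₁ tail)) ,
                   tail-on-diagonal shifted uniq distinct tail max≤len

double-ribbon-diagonal : ∀ {R S μ λ′} → DoubleRibbon μ R S → SubDiagram μ λ′ →
  MeetsDiagonal λ′ (R ++ S) × maxDiag R ≤ length R
double-ribbon-diagonal {μ = μ} {λ′}
  ((_ , _ , _ , connected , _) , _ , _ , _ , R⊆μ , _ , (t , (t∈ , _) , t-in , t-diag) , _) μ⊆λ =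
  (t , ∈-++⁺ˡ t∈ , μ⊆λ t t-in , t-diag) ,
  diagonal-cover (⊆D⇒AllShifted {μ = μ} R⊆μ) connected t∈ t-diag

mainTheorem16 : (λ′ : List ℕ) → StrictPartition λ′ → (k : ℕ) → 1 ≤ k →
    (T : SRT k λ′) → (μ : List ℕ) → (X : List Cell) → (ρ : KRibbon k μ X) →
    RibbonOf T μ X ρ →
    (Σ Cell (λ x → x ∈ X × InD λ′ x × diagC x ≡ 1)) ⇔ (ribbonDiag ρ ≤ k)
mainTheorem16 λ′ _ _ _ _ μ _ (single sr X⊆μ refl) ribbon =
  single-ribbon-diagonal {μ = μ} {λ′} sr X⊆μ (ribbon-shape-inside ribbon)
mainTheorem16 λ′ _ _ _ _ μ _ (double {R} {S} dr refl) ribbon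
  with double-ribbon-diagonal {μ = μ} {λ′} dr (ribbon-shape-inside ribbon)
... | meets , diag≤|R| =
  mk⇔ (λ _ → ≤-trans diag≤|R| (m≤m+n (length R) (length S))) (λ _ → meets)
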